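{- Let $\mathcal{A}$ be a finite alphabet and $w\in\mathcal{A}^+$ a word. Let $\mathcal{C}$ be the autocorrelation set of $w$, let $\mathcal{C}_\circ=\mathcal{C}\setminus\{\epsilon\}$, and let $\mathcal{K}=\mathcal{C}_\circ\setminus \mathcal{C}_\circ\mathcal{A}^+$. Then $\mathcal{K}$ is a prefix code that generates the language $\mathcal{C}^{\star}$ unambiguously: $\mathcal{K}^{\star}=\mathcal{C}^{\star}$, and every word of $\mathcal{C}^{\star}$ has a unique factorization as a concatenation of words of $\mathcal{K}$.
   Context: $\epsilon$ denotes the empty word, $\mathcal{A}^+=\mathcal{A}^\star\setminus\{\epsilon\}$, and $|x|$ is the length of a word $x$. The autocorrelation set of $w$ is $\mathcal{C}=\{e\in\mathcal{A}^\star : |e|<|w| \text{ and } we\in\mathcal{A}^\star w\}$, i.e. the set of words $e$ with $|e|<|w|$ such that $w$ is a suffix of $we$; in particular $\epsilon\in\mathcal{C}$. Thus $\mathcal{K}$ is the set of nonempty words of $\mathcal{C}$ having no proper nonempty prefix in $\mathcal{C}$ other than themselves, i.e. no prefix in $\mathcal{C}_\circ$ other than themselves. A prefix code is a set of words none of which is a proper prefix of another. -}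

module Defs where

open import Data.Nat using (ℕ; _<_)
open import Data.Fin using (Fin)
open import Data.List using (List; []; _∷_; _++_; length; concat)
open import Data.List.Relation.Unary.All using (All)
open import Data.Product using (Σ; ∃; _×_; _,_)
open import Relation.Nullary using (¬_)
open import Relation.Binary.PropositionalEquality using (_≡_; _≢_)

Word : ℕ → Set
Word k = List (Fin k)

Lang : ℕ → Set₁
Lang k = Word k → Set

Autocorr : {k : ℕ} → Word k → Lang k
Autocorr w e = (length e < length w) × (∃ λ u → w ++ e ≡ u ++ w)

Autocorr∘ : {k : ℕ} → Word k → Lang k
Autocorr∘ w e = Autocorr w e × (e ≢ [])

KSet : {k : ℕ} → Word k → Lang k
KSet w e = Autocorr∘ w e
         × ¬ (∃ λ p → ∃ λ s → Autocorr∘ w p × (s ≢ []) × (e ≡ p ++ s))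

data Star {k : ℕ} (L : Lang k) : Lang k where
  ε-star : Star L []
  cons-star : ∀ {x y} → L x → Star L y → Star L (x ++ y)

PrefixCode : {k : ℕ} → Lang k → Set
PrefixCode L = ∀ x s → L x → L (x ++ s) → s ≡ []

SameLang : {k : ℕ} → Lang k → Lang k → Set
SameLang L M = ∀ u → (L u → M u) × (M u → L u)

UniqueFactorization : {k : ℕ} → Lang k → Lang k → Set
UniqueFactorization L M =
  ∀ u → M u →
    (∃ λ fs → All L fs × concat fs ≡ u)
    × (∀ fs gs → All L fs → All L gs → concat fs ≡ u → concat gs ≡ u → fs ≡ gs)

-- The key fact is that the autocorrelation set C is closed under left quotient by
-- its own elements: if p and p s lie in C then so does s, because w s and w are
-- both suffixes of the word u w with w p s = u w, and w is the shorter one.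
-- Hence a word of C that has a proper nonempty prefix in C splits into two
-- shorter words of C, and induction on length writes every word of C, and so
-- every word of C*, as a product of words of K.  K is a prefix code by its very
-- definition, and factorizations over a prefix code of nonempty words are unique.
module Submission where

open import Defs
open import Data.Nat using (ℕ; _<_; _≤_; _<?_; s≤s; z≤n)
open import Data.Nat.Properties using (≤-refl; m≤n⇒m≤1+n; ≤⇒≯; ≤-<-trans; m≤m+n; ≤-reflexive; ≤-trans)
open import Data.Nat.Induction using (<-wellFounded)
open import Data.Fin using (Fin; _≟_)
open import Data.List using (List; []; _∷_; _++_; length; concat)
open import Data.List.Properties
  using (++-assoc; ++-identityʳ; ++-conicalˡ; ++-conicalʳ; ∷-injective; length-++; ≡-dec; ++-monoid)
open import Data.List.Relation.Unary.All using (All; []; _∷_)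
open import Data.List.Relation.Binary.Suffix.Heterogeneous.Properties using (suffix?)
open import Data.List.Relation.Binary.Suffix.Propositional.Properties using (Suffix-as-∣ʳ; ∣ʳ-as-Suffix)
open import Data.Product using (∃; _×_; _,_; proj₁; proj₂)
open import Data.Sum using (_⊎_; inj₁; inj₂)
open import Data.Empty using (⊥-elim)
open import Function using (_∘_)
open import Induction.WellFounded using (Acc; acc)
open import Relation.Nullary using (¬_; yes; no)
open import Relation.Nullary.Decidable using (map′; _×-dec_; ¬?)
open import Relation.Unary using (Decidable)
open import Relation.Binary.PropositionalEquality using (_≡_; _≢_; refl; sym; trans; cong; cong₂; subst; module ≡-Reasoning)

module _ {A : Set} where

  ++-equidivisible : (a b c d : List A) → a ++ b ≡ c ++ d →
    (∃ λ m → c ≡ a ++ m × b ≡ m ++ d) ⊎ (∃ λ m → a ≡ c ++ m × d ≡ m ++ b)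
  ++-equidivisible []      b c       d eq = inj₁ (c , refl , eq)
  ++-equidivisible (x ∷ a) b []      d eq = inj₂ (x ∷ a , refl , sym eq)
  ++-equidivisible (x ∷ a) b (y ∷ c) d eq with ∷-injective eq
  ... | refl , eq′ with ++-equidivisible a b c d eq′
  ...   | inj₁ (m , c≡am , b≡md) = inj₁ (m , cong (x ∷_) c≡am , b≡md)
  ...   | inj₂ (m , a≡cm , d≡mb) = inj₂ (m , cong (x ∷_) a≡cm , d≡mb)

  length-≤-++ʳ : (p s : List A) → length s ≤ length (p ++ s)
  length-≤-++ʳ []      s = ≤-refl
  length-≤-++ʳ (_ ∷ p) s = m≤n⇒m≤1+n (length-≤-++ʳ p s)

  length-<-++ˡ : (p : List A) {s : List A} → s ≢ [] → length p < length (p ++ s)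
  length-<-++ˡ []      {[]}    s≢[] = ⊥-elim (s≢[] refl)
  length-<-++ˡ []      {_ ∷ _} _    = s≤s z≤n
  length-<-++ˡ (_ ∷ p) s≢[]         = s≤s (length-<-++ˡ p s≢[])

  length-<-++ʳ : {p : List A} (s : List A) → p ≢ [] → length s < length (p ++ s)
  length-<-++ʳ {[]}    s p≢[] = ⊥-elim (p≢[] refl)
  length-<-++ʳ {_ ∷ p} s _    = s≤s (length-≤-++ʳ p s)

  ++-shorter-suffix : (a x b y : List A) → a ++ x ≡ b ++ y → length y ≤ length x →
    ∃ λ m → x ≡ m ++ y
  ++-shorter-suffix a x b y eq y≤x with ++-equidivisible a x b y eq
  ... | inj₁ (m , _ , x≡my)     = m , x≡my
  ... | inj₂ ([] , _ , refl)    = [] , refl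
  ... | inj₂ (_ ∷ m , _ , refl) = ⊥-elim (≤⇒≯ (length-≤-++ʳ m x) y≤x)

  HasProperPrefixIn : (List A → Set) → List A → Set
  HasProperPrefixIn P e = ∃ λ p → ∃ λ s → P p × (s ≢ []) × (e ≡ p ++ s)

  hasProperPrefix? : {P : List A → Set} → Decidable P → Decidable (HasProperPrefixIn P)
  hasProperPrefix? P? [] = no λ { (p , s , _ , s≢[] , eq) → s≢[] (++-conicalʳ p s (sym eq)) }
  hasProperPrefix? {P} P? (x ∷ e) with P? []
  ... | yes P[] = yes ([] , x ∷ e , P[] , (λ ()) , refl)
  ... | no ¬P[] = map′ extend restrict (hasProperPrefix? (P? ∘ (x ∷_)) e)
    where
    extend : HasProperPrefixIn (P ∘ (x ∷_)) e → HasProperPrefixIn P (x ∷ e)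
    extend (p , s , Pxp , s≢[] , e≡ps) = x ∷ p , s , Pxp , s≢[] , cong (x ∷_) e≡ps

    restrict : HasProperPrefixIn P (x ∷ e) → HasProperPrefixIn (P ∘ (x ∷_)) e
    restrict ([] , _ , P[] , _ , _) = ⊥-elim (¬P[] P[])
    restrict (y ∷ p , s , Pyp , s≢[] , eq) with ∷-injective eq
    ... | refl , e≡ps = p , s , Pyp , s≢[] , e≡ps

module _ {k : ℕ} where

  prefixCode-unique-factorization : {L : Lang k} → PrefixCode L → (∀ {x} → L x → x ≢ []) →
    ∀ fs gs → All L fs → All L gs → concat fs ≡ concat gs → fs ≡ gs
  prefixCode-unique-factorization code nonempty [] [] _ _ _ = refl
  prefixCode-unique-factorization code nonempty [] (g ∷ gs) _ (Lg ∷ _) eq =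
    ⊥-elim (nonempty Lg (++-conicalˡ g (concat gs) (sym eq)))
  prefixCode-unique-factorization code nonempty (f ∷ fs) [] (Lf ∷ _) _ eq =
    ⊥-elim (nonempty Lf (++-conicalˡ f (concat fs) eq))
  prefixCode-unique-factorization code nonempty (f ∷ fs) (g ∷ gs) (Lf ∷ Lfs) (Lg ∷ Lgs) eq
    with ++-equidivisible f (concat fs) g (concat gs) eq
  ... | inj₁ (m , refl , fs≡gs) with code f m Lf Lg
  ...   | refl = cong₂ _∷_ (sym (++-identityʳ f))
                   (prefixCode-unique-factorization code nonempty fs gs Lfs Lgs fs≡gs)
  prefixCode-unique-factorization code nonempty (f ∷ fs) (g ∷ gs) (Lf ∷ Lfs) (Lg ∷ Lgs) eq
    | inj₂ (m , refl , gs≡fs) with code g m Lg Lf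
  ...   | refl = cong₂ _∷_ (++-identityʳ g)
                   (prefixCode-unique-factorization code nonempty fs gs Lfs Lgs (sym gs≡fs))

  Star-++ : {L : Lang k} {x y : Word k} → Star L x → Star L y → Star L (x ++ y)
  Star-++ ε-star Ly = Ly
  Star-++ {L} {y = z} (cons-star {x} {y} Lx Ly) Lz =
    subst (Star L) (sym (++-assoc x y z)) (cons-star Lx (Star-++ Ly Lz))

  Star-singleton : {L : Lang k} {x : Word k} → L x → Star L x
  Star-singleton {L} {x} Lx = subst (Star L) (++-identityʳ x) (cons-star Lx ε-star)

  Star-join : {L M : Lang k} → (∀ {x} → L x → Star M x) → ∀ {u} → Star L u → Star M u
  Star-join f ε-star            = ε-star
  Star-join f (cons-star Lx Ly) = Star-++ (f Lx) (Star-join f Ly)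

  Star-map : {L M : Lang k} → (∀ {x} → L x → M x) → ∀ {u} → Star L u → Star M u
  Star-map f = Star-join (Star-singleton ∘ f)

  Star⇒factorization : {L : Lang k} {u : Word k} → Star L u → ∃ λ fs → All L fs × concat fs ≡ u
  Star⇒factorization ε-star = [] , [] , refl
  Star⇒factorization (cons-star {x} Lx Ly) with Star⇒factorization Ly
  ... | fs , Lfs , refl = x ∷ fs , Lx ∷ Lfs , refl

module _ {k : ℕ} (w : Word k) where

  open import Algebra.Properties.Monoid.Divisibility (++-monoid (Fin k)) using (_∣ʳ_; _,_)

  Autocorr? : Decidable (Autocorr w)
  Autocorr? e = (length e <? length w)
    ×-dec map′ (fromDivisor ∘ Suffix-as-∣ʳ) (∣ʳ-as-Suffix ∘ toDivisor) (suffix? _≟_ w (w ++ e))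
    where
    fromDivisor : w ∣ʳ (w ++ e) → ∃ λ u → w ++ e ≡ u ++ w
    fromDivisor (u , u++w≡w++e) = u , sym u++w≡w++e

    toDivisor : (∃ λ u → w ++ e ≡ u ++ w) → w ∣ʳ (w ++ e)
    toDivisor (u , w++e≡u++w) = u , sym w++e≡u++w

  Autocorr∘? : Decidable (Autocorr∘ w)
  Autocorr∘? e = Autocorr? e ×-dec ¬? (≡-dec _≟_ e [])

  Autocorr-leftQuotient : {p s : Word k} → Autocorr w p → Autocorr w (p ++ s) → Autocorr w s
  Autocorr-leftQuotient {p} {s} (_ , u′ , wp≡u′w) (|ps|<|w| , u , wps≡uw) =
    ≤-<-trans (length-≤-++ʳ p s) |ps|<|w| ,
    ++-shorter-suffix u′ (w ++ s) u w u′ws≡uw w≤ws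
    where
    open ≡-Reasoning
    u′ws≡uw : u′ ++ (w ++ s) ≡ u ++ w
    u′ws≡uw = begin
      u′ ++ (w ++ s)  ≡⟨ ++-assoc u′ w s ⟨
      (u′ ++ w) ++ s  ≡⟨ cong (_++ s) wp≡u′w ⟨
      (w ++ p) ++ s   ≡⟨ ++-assoc w p s ⟩
      w ++ (p ++ s)   ≡⟨ wps≡uw ⟩
      u ++ w          ∎
    w≤ws : length w ≤ length (w ++ s)
    w≤ws = ≤-trans (m≤m+n (length w) (length s)) (≤-reflexive (sym (length-++ w)))

  KSet-prefixCode : PrefixCode (KSet w)
  KSet-prefixCode x []      _  _            = refl
  KSet-prefixCode x (y ∷ s) Kx (_ , ¬split) = ⊥-elim (¬split (x , y ∷ s , proj₁ Kx , (λ ()) , refl))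

  KSet⊆Autocorr : ∀ {x} → KSet w x → Autocorr w x
  KSet⊆Autocorr = proj₁ ∘ proj₁

  KSet-nonempty : ∀ {x} → KSet w x → x ≢ []
  KSet-nonempty = proj₂ ∘ proj₁

  Autocorr⊆Star-KSet : ∀ {e} → Autocorr w e → Star (KSet w) e
  Autocorr⊆Star-KSet {e} = go e (<-wellFounded (length e))
    where
    atom : ∀ e → Autocorr w e → ¬ HasProperPrefixIn (Autocorr∘ w) e → Star (KSet w) e
    atom []      _  _      = ε-star
    atom (_ ∷ _) Ce ¬split = Star-singleton ((Ce , λ ()) , ¬split)

    go : ∀ e → Acc _<_ (length e) → Autocorr w e → Star (KSet w) e
    go e (acc rec) Ce with hasProperPrefix? Autocorr∘? e
    ... | no ¬split = atom e Ce ¬split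
    ... | yes (p , s , (Cp , p≢[]) , s≢[] , refl) =
      Star-++ (go p (rec (length-<-++ˡ p s≢[])) Cp)
              (go s (rec (length-<-++ʳ s p≢[])) (Autocorr-leftQuotient Cp Ce))

lemma1 : (k : ℕ) (w : Word k) → w ≢ [] →
    PrefixCode (KSet w)
    × SameLang (Star (KSet w)) (Star (Autocorr w))
    × UniqueFactorization (KSet w) (Star (Autocorr w))
lemma1 k w _ =
  KSet-prefixCode w ,
  (λ _ → Star-map (KSet⊆Autocorr w) , Star-join (Autocorr⊆Star-KSet w)) ,
  λ _ C*u → Star⇒factorization (Star-join (Autocorr⊆Star-KSet w) C*u) ,
            λ fs gs Kfs Kgs fs≡u gs≡u →
              prefixCode-unique-factorization (KSet-prefixCode w) (KSet-nonempty w)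
                fs gs Kfs Kgs (trans fs≡u (sym gs≡u))
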